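{- (i) $\mathsf{LPO}$ is $1$-weakly discontinuous. (ii) $\mathsf{LLPO}$ is $2$-weakly discontinuous.
   Context: A problem is a partial multivalued function $f:\subseteq \mathbb{N}^\mathbb{N} \rightrightarrows \mathbb{N}^\mathbb{N}$; $\mathrm{dom}(f)$ is the set of $x$ with $f(x)\neq\emptyset$. For $x\in\mathbb{N}^\mathbb{N}$ and $n\in\mathbb{N}$, $x|_n$ is the initial segment of $x$ of length $n$. For positive $k\in\mathbb{N}$, $f$ is $k$-weakly continuous iff for every $x\in\mathrm{dom}(f)$ and every sequence $(y_n)_{n\in\mathbb{N}}\subseteq\mathrm{dom}(f)$ with $\lim_{n\to\infty}y_n=x$, there is $u\in f(x)$ such that for every $l<k$ and every $m\in\mathbb{N}$ there exist $n\ge m$ and $v\in f(y_{n\cdot k+l})$ with $u|_m=v|_m$. $f$ is $k$-weakly discontinuous iff it is not $k$-weakly continuous. With $\mathbf{n}$ the constant sequence of value $n$: $\mathsf{LPO}(x)=\mathbf{0}$ if $x$ has a zero entry and $\mathbf{1}$ otherwise (total). $\mathsf{LLPO}$ has domain the sequences with at most one non-zero entry, and $\mathsf{LLPO}(x)$ contains $\mathbf{0}$ iff $x$ is zero at all even indices, and contains $\mathbf{1}$ iff $x$ is zero at all odd indices. -}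

module Defs where

open import Data.Nat using (ℕ; zero; suc; _+_; _*_; _<_; _≥_)
open import Data.Product using (Σ; _×_; ∃; ∃-syntax)
open import Data.Sum using (_⊎_)
open import Relation.Binary.PropositionalEquality using (_≡_; _≢_)
open import Relation.Nullary using (¬_)

Baire : Set
Baire = ℕ → ℕ

-- A problem f :⊆ ℕ^ℕ ⇉ ℕ^ℕ, given by its graph: Problem f, f x u means u ∈ f(x).
Problem : Set₁
Problem = Baire → Baire → Set

dom : Problem → Baire → Set
dom f x = ∃[ u ] f x u

_≡[_]_ : Baire → ℕ → Baire → Set
u ≡[ m ] v = ∀ i → i < m → u i ≡ v i

Converges : (ℕ → Baire) → Baire → Set
Converges y x = ∀ m → ∃[ N ] (∀ n → n ≥ N → y n ≡[ m ] x)

WeaklyContinuous : ℕ → Problem → Set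
WeaklyContinuous k f =
  ∀ (x : Baire) → dom f x →
  ∀ (y : ℕ → Baire) → (∀ n → dom f (y n)) → Converges y x →
  ∃[ u ] (f x u ×
    (∀ l → l < k → ∀ m → ∃[ n ] (n ≥ m × ∃[ v ] (f (y (n * k + l)) v × u ≡[ m ] v))))

WeaklyDiscontinuous : ℕ → Problem → Set
WeaklyDiscontinuous k f = ¬ WeaklyContinuous k f

IsConst : ℕ → Baire → Set
IsConst c u = ∀ i → u i ≡ c

LPO : Problem
LPO x u = ((∃[ i ] x i ≡ 0) × IsConst 0 u) ⊎ ((∀ i → x i ≢ 0) × IsConst 1 u)

AtMostOneNonzero : Baire → Set
AtMostOneNonzero x = ∀ i j → x i ≢ 0 → x j ≢ 0 → i ≡ j

LLPO : Problem
LLPO x u = AtMostOneNonzero x ×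
  (((∀ i → x (2 * i) ≡ 0) × IsConst 0 u) ⊎ ((∀ i → x (2 * i + 1) ≡ 0) × IsConst 1 u))

-- (i) The sequences 1ⁿ0^ω converge to 1^ω. LPO answers 1^ω at the limit but
-- 0^ω at every member of the sequence, so the answers differ already at position 0.
-- (ii) The unit sequences eₙ (1 at n, 0 elsewhere) converge to 0^ω. LLPO must answer
-- 1^ω at e₂ₙ and 0^ω at e₂ₙ₊₁; whichever answer u ∈ LLPO(0^ω) is chosen, one of the
-- two subsequences disagrees with u at position 0 from the start.
module Submission where

open import Defs
open import Data.Nat using (ℕ; zero; suc; _+_; _*_; _<_; _≟_; s≤s; z≤n)
open import Data.Nat.Properties
  using (<⇒≢; <-≤-trans; +-suc; +-comm; +-identityʳ; *-comm; even≢odd)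
open import Data.Product using (_×_; _,_; ∃-syntax)
open import Data.Sum using (_⊎_; inj₁; inj₂)
open import Function using (_∘_; const)
open import Relation.Binary.PropositionalEquality using (_≡_; _≢_; refl; sym; trans; cong)
open import Relation.Nullary using (yes; no; contradiction)

WeaklyDiscontinuous-by-separation :
  ∀ {k f x} (y : ℕ → Baire) → dom f x → (∀ n → dom f (y n)) → Converges y x →
  (∀ {u} → f x u → ∃[ l ] (l < k × ∀ n {v} → f (y (n * k + l)) v → u 0 ≢ v 0)) →
  WeaklyDiscontinuous k f
WeaklyDiscontinuous-by-separation y x∈dom y∈dom y→x separate wc
  with wc _ x∈dom y y∈dom y→x
... | u , fxu , approximated with separate fxu
...   | l , l<k , apart with approximated l l<k 1
...     | n , _ , v , fyv , u≡v = apart n fyv (u≡v 0 (s≤s z≤n))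

Converges-by-prefixes : ∀ {y x} → (∀ n → y n ≡[ n ] x) → Converges y x
Converges-by-prefixes agree m = m , λ n n≥m i i<m → agree n i (<-≤-trans i<m n≥m)

IsConst-apart : ∀ {a b u v} → a ≢ b → IsConst a u → IsConst b v → u 0 ≢ v 0
IsConst-apart a≢b u≡a v≡b u0≡v0 = a≢b (trans (sym (u≡a 0)) (trans u0≡v0 (v≡b 0)))

even-or-odd : ∀ j → (∃[ q ] j ≡ 2 * q) ⊎ (∃[ q ] j ≡ suc (2 * q))
even-or-odd zero = inj₁ (0 , refl)
even-or-odd (suc j) with even-or-odd j
... | inj₁ (q , refl) = inj₂ (q , refl)
... | inj₂ (q , refl) = inj₁ (suc q , cong suc (sym (+-suc q (q + 0))))

LPO-at-zero : ∀ {x u i} → x i ≡ 0 → LPO x u → IsConst 0 u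
LPO-at-zero _ (inj₁ (_ , u≡0)) = u≡0
LPO-at-zero xi≡0 (inj₂ (x≢0 , _)) = contradiction xi≡0 (x≢0 _)

LPO-nowhere-zero : ∀ {x u} → (∀ i → x i ≢ 0) → LPO x u → IsConst 1 u
LPO-nowhere-zero x≢0 (inj₁ ((i , xi≡0) , _)) = contradiction xi≡0 (x≢0 i)
LPO-nowhere-zero _ (inj₂ (_ , u≡1)) = u≡1

onesBelow : ℕ → Baire
onesBelow zero i = 0
onesBelow (suc n) zero = 1
onesBelow (suc n) (suc i) = onesBelow n i

onesBelow-end : ∀ n → onesBelow n n ≡ 0
onesBelow-end zero = refl
onesBelow-end (suc n) = onesBelow-end n

onesBelow-prefix : ∀ n → onesBelow n ≡[ n ] const 1
onesBelow-prefix (suc n) zero _ = refl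
onesBelow-prefix (suc n) (suc i) (s≤s i<n) = onesBelow-prefix n i i<n

LPO-weaklyDiscontinuous : WeaklyDiscontinuous 1 LPO
LPO-weaklyDiscontinuous =
  WeaklyDiscontinuous-by-separation onesBelow
    (const 1 , inj₂ (nowhere-zero , λ _ → refl))
    (λ n → const 0 , inj₁ ((n , onesBelow-end n) , λ _ → refl))
    (Converges-by-prefixes onesBelow-prefix)
    (λ fxu → 0 , s≤s z≤n , λ n fyv →
      IsConst-apart (λ ()) (LPO-nowhere-zero nowhere-zero fxu)
                           (LPO-at-zero (onesBelow-end (n * 1 + 0)) fyv))
  where
  nowhere-zero : ∀ i → const 1 i ≢ 0
  nowhere-zero _ ()

LLPO-even-nonzero : ∀ {x v} i → x (2 * i) ≢ 0 → LLPO x v → IsConst 1 v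
LLPO-even-nonzero i x≢0 (_ , inj₁ (evens≡0 , _)) = contradiction (evens≡0 i) x≢0
LLPO-even-nonzero _ _ (_ , inj₂ (_ , v≡1)) = v≡1

LLPO-odd-nonzero : ∀ {x v} i → x (2 * i + 1) ≢ 0 → LLPO x v → IsConst 0 v
LLPO-odd-nonzero _ _ (_ , inj₁ (_ , v≡0)) = v≡0
LLPO-odd-nonzero i x≢0 (_ , inj₂ (odds≡0 , _)) = contradiction (odds≡0 i) x≢0

spike : ℕ → Baire
spike zero zero = 1
spike zero (suc i) = 0
spike (suc j) zero = 0
spike (suc j) (suc i) = spike j i

spike-peak : ∀ {i j} → i ≡ j → spike j i ≢ 0
spike-peak {zero} refl = λ ()
spike-peak {suc i} refl = spike-peak {i} refl

spike-off : ∀ {i j} → i ≢ j → spike j i ≡ 0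
spike-off {zero} {zero} i≢j = contradiction refl i≢j
spike-off {zero} {suc j} _ = refl
spike-off {suc i} {zero} _ = refl
spike-off {suc i} {suc j} i≢j = spike-off (i≢j ∘ cong suc)

spike-atMostOneNonzero : ∀ j → AtMostOneNonzero (spike j)
spike-atMostOneNonzero j a b a≢0 b≢0 = trans (at-peak a≢0) (sym (at-peak b≢0))
  where
  at-peak : ∀ {i} → spike j i ≢ 0 → i ≡ j
  at-peak {i} i≢0 with i ≟ j
  ... | yes i≡j = i≡j
  ... | no i≢j = contradiction (spike-off i≢j) i≢0

spike∈dom-LLPO : ∀ j → dom LLPO (spike j)
spike∈dom-LLPO j with even-or-odd j
... | inj₁ (q , refl) = const 1 , spike-atMostOneNonzero j ,
  inj₂ ((λ i → spike-off (λ e → even≢odd q i (trans (sym e) (+-comm (2 * i) 1)))) , λ _ → refl)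
... | inj₂ (q , refl) = const 0 , spike-atMostOneNonzero j ,
  inj₁ ((λ i → spike-off (even≢odd i q)) , λ _ → refl)

spike-prefix : ∀ n → spike n ≡[ n ] const 0
spike-prefix n i i<n = spike-off (<⇒≢ i<n)

LLPO-weaklyDiscontinuous : WeaklyDiscontinuous 2 LLPO
LLPO-weaklyDiscontinuous =
  WeaklyDiscontinuous-by-separation spike
    (const 0 , zero-atMostOneNonzero , inj₁ ((λ _ → refl) , λ _ → refl))
    spike∈dom-LLPO
    (Converges-by-prefixes spike-prefix)
    separate
  where
  zero-atMostOneNonzero : AtMostOneNonzero (const 0)
  zero-atMostOneNonzero _ _ 0≢0 _ = contradiction refl 0≢0

  separate : ∀ {u} → LLPO (const 0) u → ∃[ l ] (l < 2 × ∀ n {v} → LLPO (spike (n * 2 + l)) v → u 0 ≢ v 0)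
  separate (_ , inj₁ (_ , u≡0)) = 0 , s≤s z≤n , λ n fyv →
    IsConst-apart (λ ()) u≡0
      (LLPO-even-nonzero n (spike-peak (trans (*-comm 2 n) (sym (+-identityʳ (n * 2))))) fyv)
  separate (_ , inj₂ (_ , u≡1)) = 1 , s≤s (s≤s z≤n) , λ n fyv →
    IsConst-apart (λ ()) u≡1
      (LLPO-odd-nonzero n (spike-peak (cong (_+ 1) (*-comm 2 n))) fyv)

lemma3p2 : WeaklyDiscontinuous 1 LPO × WeaklyDiscontinuous 2 LLPO
lemma3p2 = LPO-weaklyDiscontinuous , LLPO-weaklyDiscontinuous
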